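{- Let $w$ be a permutation. If $\overline{\mathcal{P}}(w)$ has an element that covers at least $3$ elements, then $\overline{\mathcal{P}}(w)$ is not a distributive lattice.
   Context: For $w \in \mathfrak{S}_n$ in one-line notation $w(1)\cdots w(n)$, an interval of $w$ is a set of consecutive integers $[h,h+j]$ (possibly empty) with $\{w(t) : t \in [i,i+j]\} = [h,h+j]$ for some $i$. $\mathcal{P}(w)$ is the set of nonempty intervals of $w$ ordered by inclusion, and $\overline{\mathcal{P}}(w)$ is $\mathcal{P}(w)$ with a minimum element $\widehat{0}$ (the empty interval) adjoined; it is a lattice. -}

module Defs where

open import Data.Nat using (ℕ; _≤_; _+_; _∸_)
open import Data.Fin using (Fin; toℕ)
open import Data.Fin.Permutation using (Permutation′; _⟨$⟩ʳ_)
open import Data.Maybe using (Maybe; just; nothing)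
open import Data.Product using (Σ; ∃; _×_)
open import Data.Empty using (⊥)
open import Relation.Nullary using (¬_)
open import Relation.Binary.PropositionalEquality using (_≡_)

-- Positions and values are 0-based: w(t) for t ∈ {0,…,n-1}.
IsInterval : {n : ℕ} → Permutation′ n → ℕ → ℕ → Set
IsInterval {n} w lo hi =
  ∃ λ (i : ℕ) → (∀ (v : ℕ) →
      ((lo ≤ v × v ≤ hi) →
         Σ (Fin n) λ t → (i ≤ toℕ t × toℕ t ≤ i + (hi ∸ lo)) × toℕ (w ⟨$⟩ʳ t) ≡ v)
    × ((Σ (Fin n) λ t → (i ≤ toℕ t × toℕ t ≤ i + (hi ∸ lo)) × toℕ (w ⟨$⟩ʳ t) ≡ v) →
         (lo ≤ v × v ≤ hi)))

record Interval {n : ℕ} (w : Permutation′ n) : Set where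
  constructor mkInterval
  field
    lo hi : ℕ
    lo≤hi : lo ≤ hi
    isInterval : IsInterval w lo hi

-- elements of 𝒫̄(w): nothing is the adjoined minimum 0̂ (empty interval)
PBar : {n : ℕ} → Permutation′ n → Set
PBar w = Maybe (Interval w)

_∈ᴾ_ : {n : ℕ} {w : Permutation′ n} → ℕ → PBar w → Set
v ∈ᴾ nothing = ⊥
v ∈ᴾ just I = Interval.lo I ≤ v × v ≤ Interval.hi I

_⊑_ : {n : ℕ} {w : Permutation′ n} → PBar w → PBar w → Set
x ⊑ y = ∀ v → v ∈ᴾ x → v ∈ᴾ y

_≈ᴾ_ : {n : ℕ} {w : Permutation′ n} → PBar w → PBar w → Set
x ≈ᴾ y = x ⊑ y × y ⊑ x

_⊏_ : {n : ℕ} {w : Permutation′ n} → PBar w → PBar w → Set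
x ⊏ y = x ⊑ y × ¬ (y ⊑ x)

Covers : {n : ℕ} {w : Permutation′ n} → PBar w → PBar w → Set
Covers {w = w} x y = y ⊏ x × ¬ (∃ λ (z : PBar w) → y ⊏ z × z ⊏ x)

CoversAtLeast3 : {n : ℕ} {w : Permutation′ n} → PBar w → Set
CoversAtLeast3 {w = w} x =
  ∃ λ (a : PBar w) → ∃ λ (b : PBar w) → ∃ λ (c : PBar w) →
    Covers x a × Covers x b × Covers x c
    × ¬ (a ≈ᴾ b) × ¬ (a ≈ᴾ c) × ¬ (b ≈ᴾ c)

IsMeet : {n : ℕ} {w : Permutation′ n} → PBar w → PBar w → PBar w → Set
IsMeet {w = w} x y m = m ⊑ x × m ⊑ y × (∀ (z : PBar w) → z ⊑ x → z ⊑ y → z ⊑ m)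

IsJoin : {n : ℕ} {w : Permutation′ n} → PBar w → PBar w → PBar w → Set
IsJoin {w = w} x y j = x ⊑ j × y ⊑ j × (∀ (z : PBar w) → x ⊑ z → y ⊑ z → j ⊑ z)

IsDistributive : {n : ℕ} → Permutation′ n → Set
IsDistributive w =
  ∀ (x y z yz m xy xz r : PBar w) →
    IsJoin y z yz → IsMeet x yz m → IsMeet x y xy → IsMeet x z xz → IsJoin xy xz r →
    m ≈ᴾ r

-- Nonempty intersections of intervals of w are intervals: on the common window of positions, w
-- restricts to an injection onto the common range of values and back, so both have the same
-- size. Hence 𝒫̄(w) has meets, and two distinct covers b, c of x have join x. Distinct covers
-- of x are incomparable intervals, so their lower endpoints are distinct; if lo A < lo B < lo C
-- then also hi A ≤ hi B and A ∧ C ⊑ B. Distributivity would give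
-- A = A ∧ (B ∨ C) = (A ∧ B) ∨ (A ∧ C) = A ∧ B ⊑ B, contradicting incomparability.
module Submission where

open import Defs
open import Data.Nat using (ℕ; suc; _+_; _∸_; _≤_; _<_; _⊔_; _⊓_; s≤s; s≤s⁻¹; _≤?_)
open import Data.Nat.Properties
open import Data.Fin using (Fin; toℕ; fromℕ<)
open import Data.Fin.Properties using (toℕ-injective; toℕ<n; toℕ-fromℕ<; injective⇒≤)
open import Data.Fin.Permutation using (Permutation′; _⟨$⟩ʳ_; _⟨$⟩ˡ_; inverseˡ)
open import Data.Maybe using (just; nothing)
open import Data.Product using (Σ; ∃; _×_; _,_; proj₁; proj₂)
open import Data.Sum using (_⊎_; inj₁; inj₂)
open import Data.Empty using (⊥-elim)
open import Relation.Nullary using (¬_; Dec; yes; no)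
open import Relation.Binary using (tri<; tri≈; tri>)
open import Relation.Binary.PropositionalEquality
  using (_≡_; _≢_; refl; sym; trans; cong; subst; module ≡-Reasoning)

open ≡-Reasoning

injective-into-range⇒≤ : ∀ {k b c} (f : Fin k → ℕ) → (∀ x → b ≤ f x) → (∀ x → f x < c) →
  (∀ {x y} → f x ≡ f y → x ≡ y) → k ≤ c ∸ b
injective-into-range⇒≤ {b = b} f b≤f f<c f-injective = injective⇒≤ shifted-injective
  where
  shifted : Fin _ → Fin _
  shifted x = fromℕ< (∸-monoˡ-< (f<c x) (b≤f x))

  shifted-injective : ∀ {x y} → shifted x ≡ shifted y → x ≡ y
  shifted-injective {x} {y} eq = f-injective (∸-cancelʳ-≡ (b≤f x) (b≤f y) (begin
    f x ∸ b           ≡⟨ toℕ-fromℕ< _ ⟨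
    toℕ (shifted x)   ≡⟨ cong toℕ eq ⟩
    toℕ (shifted y)   ≡⟨ toℕ-fromℕ< _ ⟩
    f y ∸ b           ∎))

InRange : ℕ → ℕ → ℕ → Set
InRange l h v = l ≤ v × v ≤ h

inRange-∩ : ∀ {a b c d x} → InRange a b x → InRange c d x → InRange (a ⊔ c) (b ⊓ d) x
inRange-∩ (a≤x , x≤b) (c≤x , x≤d) = ⊔-lub a≤x c≤x , ⊓-glb x≤b x≤d

inRange-∩⁻ : ∀ a b c d {x} → InRange (a ⊔ c) (b ⊓ d) x → InRange a b x × InRange c d x
inRange-∩⁻ a b c d (a⊔c≤x , x≤b⊓d) =
  (≤-trans (m≤m⊔n a c) a⊔c≤x , ≤-trans x≤b⊓d (m⊓n≤m b d)) ,
  (≤-trans (m≤n⊔m a c) a⊔c≤x , ≤-trans x≤b⊓d (m⊓n≤n b d))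

Between : ℕ → ℕ → ℕ → Set
Between a b c = (a < b × b < c) ⊎ (c < b × b < a)

some-between : ∀ {a b c} → a ≢ b → a ≢ c → b ≢ c → Between a b c ⊎ Between b a c ⊎ Between a c b
some-between {a} {b} {c} a≢b a≢c b≢c with <-cmp a b | <-cmp b c
... | tri≈ _ a≡b _ | _             = ⊥-elim (a≢b a≡b)
... | _            | tri≈ _ b≡c _  = ⊥-elim (b≢c b≡c)
... | tri< a<b _ _ | tri< b<c _ _  = inj₁ (inj₁ (a<b , b<c))
... | tri> _ _ b<a | tri> _ _ c<b  = inj₁ (inj₂ (c<b , b<a))
... | tri< a<b _ _ | tri> _ _ c<b with <-cmp a c
...   | tri< a<c _ _ = inj₂ (inj₂ (inj₁ (a<c , c<b)))
...   | tri≈ _ a≡c _ = ⊥-elim (a≢c a≡c)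
...   | tri> _ _ c<a = inj₂ (inj₁ (inj₂ (c<a , a<b)))
some-between {a} {b} {c} a≢b a≢c b≢c | tri> _ _ b<a | tri< b<c _ _ with <-cmp a c
...   | tri< a<c _ _ = inj₂ (inj₁ (inj₁ (b<a , a<c)))
...   | tri≈ _ a≡c _ = ⊥-elim (a≢c a≡c)
...   | tri> _ _ c<a = inj₂ (inj₂ (inj₂ (b<c , c<a)))

module _ {n : ℕ} (w : Permutation′ n) where

  value : Fin n → ℕ
  value t = toℕ (w ⟨$⟩ʳ t)

  value-injective : ∀ {s t} → value s ≡ value t → s ≡ t
  value-injective {s} {t} eq = begin
    s                   ≡⟨ inverseˡ w ⟨
    w ⟨$⟩ˡ (w ⟨$⟩ʳ s)   ≡⟨ cong (w ⟨$⟩ˡ_) (toℕ-injective eq) ⟩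
    w ⟨$⟩ˡ (w ⟨$⟩ʳ t)   ≡⟨ inverseˡ w ⟩
    t                   ∎

  OccursIn : ℕ → ℕ → ℕ → Set
  OccursIn i j v = Σ (Fin n) λ t → InRange i j (toℕ t) × value t ≡ v

  -- IsInterval w l h unfolds to ∃ λ i → Fills i (i + (h ∸ l)) l h.
  Fills : ℕ → ℕ → ℕ → ℕ → Set
  Fills i j l h = ∀ v → (InRange l h v → OccursIn i j v) × (OccursIn i j v → InRange l h v)

  values-fit-in-positions : ∀ {i j l h} c → l ≤ h → (∀ v → InRange l h v → OccursIn i j v) →
    (∀ (t : Fin n) → toℕ t ≤ j → toℕ t < c) → suc (h ∸ l) ≤ c ∸ i
  values-fit-in-positions {i} {j} {l} {h} c l≤h occurs bounded =
    injective-into-range⇒≤ position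
      (λ k → proj₁ (proj₁ (proj₂ (found k))))
      (λ k → bounded _ (proj₂ (proj₁ (proj₂ (found k)))))
      position-injective
    where
    found : (k : Fin (suc (h ∸ l))) → OccursIn i j (toℕ k + l)
    found k = occurs _ (m≤n+m l (toℕ k) , m≤o∸n⇒m+n≤o (toℕ k) l≤h (s≤s⁻¹ (toℕ<n k)))

    position : Fin (suc (h ∸ l)) → ℕ
    position k = toℕ (proj₁ (found k))

    position-injective : ∀ {k k′} → position k ≡ position k′ → k ≡ k′
    position-injective {k} {k′} eq = toℕ-injective (+-cancelʳ-≡ l _ _ (begin
      toℕ k + l                ≡⟨ proj₂ (proj₂ (found k)) ⟨
      value (proj₁ (found k))  ≡⟨ cong value (toℕ-injective eq) ⟩
      value (proj₁ (found k′)) ≡⟨ proj₂ (proj₂ (found k′)) ⟩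
      toℕ k′ + l               ∎))

  positions-fit-in-values : ∀ {i j l h} → i ≤ j → j < n → l ≤ h →
    (∀ (t : Fin n) → InRange i j (toℕ t) → InRange l h (value t)) → j ∸ i ≤ h ∸ l
  positions-fit-in-values {i} {j} {l} {h} i≤j j<n l≤h inRange =
    s≤s⁻¹ (subst (suc (j ∸ i) ≤_) (+-∸-assoc 1 l≤h)
      (injective-into-range⇒≤ (λ k → value (position k))
        (λ k → proj₁ (inRange _ (position-inRange k)))
        (λ k → s≤s (proj₂ (inRange _ (position-inRange k))))
        (λ eq → toℕ-injective (+-cancelʳ-≡ i _ _ (position-injective (value-injective eq))))))
    where
    k+i≤j : (k : Fin (suc (j ∸ i))) → toℕ k + i ≤ j
    k+i≤j k = m≤o∸n⇒m+n≤o (toℕ k) i≤j (s≤s⁻¹ (toℕ<n k))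

    position : Fin (suc (j ∸ i)) → Fin n
    position k = fromℕ< (≤-<-trans (k+i≤j k) j<n)

    position-inRange : ∀ k → InRange i j (toℕ (position k))
    position-inRange k rewrite toℕ-fromℕ< (≤-<-trans (k+i≤j k) j<n) = m≤n+m i (toℕ k) , k+i≤j k

    position-injective : ∀ {k k′} → position k ≡ position k′ → toℕ k + i ≡ toℕ k′ + i
    position-injective {k} {k′} eq = begin
      toℕ k + i              ≡⟨ toℕ-fromℕ< _ ⟨
      toℕ (position k)       ≡⟨ cong toℕ eq ⟩
      toℕ (position k′)      ≡⟨ toℕ-fromℕ< _ ⟩
      toℕ k′ + i             ∎

  fills⇒window<n : ∀ {i l h} → l ≤ h → Fills i (i + (h ∸ l)) l h → i + (h ∸ l) < n
  fills⇒window<n {i} {l} {h} l≤h fills =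
    subst (_≤ n) (cong suc (+-comm (h ∸ l) i)) (m≤o∸n⇒m+n≤o (suc (h ∸ l)) i≤n size≤)
    where
    size≤ : suc (h ∸ l) ≤ n ∸ i
    size≤ = values-fit-in-positions n l≤h (λ v → proj₁ (fills v)) (λ t _ → toℕ<n t)

    i≤n : i ≤ n
    i≤n = <⇒≤ (m∸n≢0⇒n<m (m<n⇒n≢0 size≤))

  fills⇒isInterval : ∀ {i j l h} → i ≤ j → j < n → l ≤ h → Fills i j l h → IsInterval w l h
  fills⇒isInterval {i} {j} {l} {h} i≤j j<n l≤h fills = i , subst (λ j → Fills i j l h) j≡i+[h∸l] fills
    where
    j∸i≡h∸l : j ∸ i ≡ h ∸ l
    j∸i≡h∸l = ≤-antisym
      (positions-fit-in-values i≤j j<n l≤h (λ t t∈ → proj₂ (fills (value t)) (t , t∈ , refl)))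
      (s≤s⁻¹ (subst (suc (h ∸ l) ≤_) (+-∸-assoc 1 i≤j)
        (values-fit-in-positions (suc j) l≤h (λ v → proj₁ (fills v)) (λ _ → s≤s))))

    j≡i+[h∸l] : j ≡ i + (h ∸ l)
    j≡i+[h∸l] = trans (sym (m+[n∸m]≡n i≤j)) (cong (i +_) j∸i≡h∸l)

  fills-∩ : ∀ {i₁ j₁ l₁ h₁ i₂ j₂ l₂ h₂} → Fills i₁ j₁ l₁ h₁ → Fills i₂ j₂ l₂ h₂ →
    Fills (i₁ ⊔ i₂) (j₁ ⊓ j₂) (l₁ ⊔ l₂) (h₁ ⊓ h₂)
  fills-∩ {i₁} {j₁} {l₁} {h₁} {i₂} {j₂} {l₂} {h₂} fills₁ fills₂ v = occurs , inRange
    where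
    occurs : InRange (l₁ ⊔ l₂) (h₁ ⊓ h₂) v → OccursIn (i₁ ⊔ i₂) (j₁ ⊓ j₂) v
    occurs v∈ with inRange-∩⁻ l₁ h₁ l₂ h₂ v∈
    ... | v∈₁ , v∈₂ with proj₁ (fills₁ v) v∈₁ | proj₁ (fills₂ v) v∈₂
    ... | t₁ , t₁∈ , eq₁ | t₂ , t₂∈ , eq₂ with value-injective (trans eq₁ (sym eq₂))
    ... | refl = t₁ , inRange-∩ t₁∈ t₂∈ , eq₁

    inRange : OccursIn (i₁ ⊔ i₂) (j₁ ⊓ j₂) v → InRange (l₁ ⊔ l₂) (h₁ ⊓ h₂) v
    inRange (t , t∈ , eq) with inRange-∩⁻ i₁ j₁ i₂ j₂ t∈
    ... | t∈₁ , t∈₂ =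
      inRange-∩ (proj₂ (fills₁ v) (t , t∈₁ , eq)) (proj₂ (fills₂ v) (t , t∈₂ , eq))

  isInterval-∩ : ∀ {l₁ h₁ l₂ h₂} → l₁ ≤ h₁ → IsInterval w l₁ h₁ → IsInterval w l₂ h₂ →
    l₁ ⊔ l₂ ≤ h₁ ⊓ h₂ → IsInterval w (l₁ ⊔ l₂) (h₁ ⊓ h₂)
  isInterval-∩ {l₁} {h₁} {l₂} {h₂} l₁≤h₁ (i₁ , fills₁) (i₂ , fills₂) L≤H =
    fills⇒isInterval I≤J J<n L≤H fills
    where
    j₁ j₂ : ℕ
    j₁ = i₁ + (h₁ ∸ l₁)
    j₂ = i₂ + (h₂ ∸ l₂)

    fills : Fills (i₁ ⊔ i₂) (j₁ ⊓ j₂) (l₁ ⊔ l₂) (h₁ ⊓ h₂)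
    fills = fills-∩ fills₁ fills₂

    I≤J : i₁ ⊔ i₂ ≤ j₁ ⊓ j₂
    I≤J = let (_ , (I≤t , t≤J) , _) = proj₁ (fills _) (≤-refl , L≤H) in ≤-trans I≤t t≤J

    J<n : j₁ ⊓ j₂ < n
    J<n = ≤-<-trans (m⊓n≤m _ _) (fills⇒window<n l₁≤h₁ fills₁)

module _ {n : ℕ} {w : Permutation′ n} where

  open Interval

  bounds⇒⊑ : {A B : Interval w} → lo B ≤ lo A → hi A ≤ hi B → just A ⊑ just B
  bounds⇒⊑ loB≤loA hiA≤hiB _ (loA≤v , v≤hiA) = ≤-trans loB≤loA loA≤v , ≤-trans v≤hiA hiA≤hiB

  meet : (p q : PBar w) → Σ (PBar w) (IsMeet p q)
  meet nothing _ = nothing , (λ _ ()) , (λ _ ()) , (λ _ z⊑p _ → z⊑p)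
  meet (just _) nothing = nothing , (λ _ ()) , (λ _ ()) , (λ _ _ z⊑q → z⊑q)
  meet (just (mkInterval l₁ h₁ l₁≤h₁ I₁)) (just (mkInterval l₂ h₂ _ I₂)) with l₁ ⊔ l₂ ≤? h₁ ⊓ h₂
  ... | yes L≤H = just (mkInterval _ _ L≤H (isInterval-∩ w l₁≤h₁ I₁ I₂ L≤H)) ,
        (λ _ v∈ → proj₁ (inRange-∩⁻ l₁ h₁ l₂ h₂ v∈)) ,
        (λ _ v∈ → proj₂ (inRange-∩⁻ l₁ h₁ l₂ h₂ v∈)) ,
        (λ _ z⊑p z⊑q v v∈z → inRange-∩ (z⊑p v v∈z) (z⊑q v v∈z))
  ... | no L≰H = nothing , (λ _ ()) , (λ _ ()) ,
        (λ _ z⊑p z⊑q v v∈z →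
          L≰H (let (L≤v , v≤H) = inRange-∩ (z⊑p v v∈z) (z⊑q v v∈z) in ≤-trans L≤v v≤H))

  _⊑?_ : (p q : PBar w) → Dec (p ⊑ q)
  nothing ⊑? _ = yes (λ _ ())
  just (mkInterval l h l≤h _) ⊑? nothing = no (λ p⊑q → p⊑q l (≤-refl , l≤h))
  just A@(mkInterval l₁ h₁ l₁≤h₁ _) ⊑? just B@(mkInterval l₂ h₂ _ _) with l₂ ≤? l₁ | h₁ ≤? h₂
  ... | yes l₂≤l₁ | yes h₁≤h₂ = yes (bounds⇒⊑ {A} {B} l₂≤l₁ h₁≤h₂)
  ... | no l₂≰l₁  | _         = no (λ p⊑q → l₂≰l₁ (proj₁ (p⊑q l₁ (≤-refl , l₁≤h₁))))
  ... | yes _     | no h₁≰h₂  = no (λ p⊑q → h₁≰h₂ (proj₂ (p⊑q h₁ (l₁≤h₁ , ≤-refl))))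

  ⊑-trans : {p q r : PBar w} → p ⊑ q → q ⊑ r → p ⊑ r
  ⊑-trans p⊑q q⊑r v v∈p = q⊑r v (p⊑q v v∈p)

  ≉-sym : {p q : PBar w} → ¬ p ≈ᴾ q → ¬ q ≈ᴾ p
  ≉-sym p≉q (q⊑p , p⊑q) = p≉q (p⊑q , q⊑p)

  covers⇒⋢ : ∀ {x} (a b : PBar w) → Covers x a → Covers x b → ¬ a ≈ᴾ b → ¬ a ⊑ b
  covers⇒⋢ _ b (_ , nothing-between) (b⊏x , _) a≉b a⊑b =
    nothing-between (b , (a⊑b , λ b⊑a → a≉b (a⊑b , b⊑a)) , b⊏x)

  -- Any upper bound z of b and c meets x in an element m with b ⊑ m ⊑ x; m ≠ b since c ⊑ m, so m = x.
  covers⇒isJoin : {x b c : PBar w} → Covers x b → Covers x c → ¬ b ≈ᴾ c → IsJoin b c x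
  covers⇒isJoin {x} {b} {c} cov-b@((b⊑x , _) , nothing-between) cov-c@((c⊑x , _) , _) b≉c =
    b⊑x , c⊑x , least
    where
    least : (z : PBar w) → b ⊑ z → c ⊑ z → x ⊑ z
    least z b⊑z c⊑z with meet x z
    ... | m , m⊑x , m⊑z , glb with x ⊑? m
    ... | yes x⊑m = ⊑-trans x⊑m m⊑z
    ... | no x⋢m = ⊥-elim (nothing-between (m , (glb b b⊑x b⊑z , m⋢b) , (m⊑x , x⋢m)))
      where
      m⋢b : ¬ m ⊑ b
      m⋢b m⊑b = covers⇒⋢ c b cov-c cov-b (≉-sym {b} {c} b≉c) (⊑-trans (glb c c⊑x c⊑z) m⊑b)

  distributive⇒covers-meet⋢ : IsDistributive w → ∀ {x} (a b c : PBar w) →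
    Covers x a → Covers x b → Covers x c → ¬ a ≈ᴾ b → ¬ b ≈ᴾ c →
    ¬ (∀ z → z ⊑ a → z ⊑ c → z ⊑ b)
  distributive⇒covers-meet⋢ distributive {x} a b c cov-a cov-b cov-c a≉b b≉c lower⊑b
    with meet a b | meet a c
  ... | a∧b , a∧b⊑a , a∧b⊑b , glb-ab | a∧c , a∧c⊑a , a∧c⊑c , glb-ac =
    covers⇒⋢ a b cov-a cov-b a≉b (⊑-trans (proj₁ a≈a∧b) a∧b⊑b)
    where
    a∧c⊑a∧b : a∧c ⊑ a∧b
    a∧c⊑a∧b = glb-ab a∧c a∧c⊑a (lower⊑b a∧c a∧c⊑a a∧c⊑c)

    a≈a∧b : a ≈ᴾ a∧b
    a≈a∧b = distributive a b c x a a∧b a∧c a∧b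
      (covers⇒isJoin cov-b cov-c b≉c)
      ((λ _ v∈ → v∈) , proj₁ (proj₁ cov-a) , (λ _ z⊑a _ → z⊑a))
      (a∧b⊑a , a∧b⊑b , glb-ab)
      (a∧c⊑a , a∧c⊑c , glb-ac)
      ((λ _ v∈ → v∈) , a∧c⊑a∧b , (λ _ a∧b⊑z _ → a∧b⊑z))

  covers⇒lo≢ : ∀ {x} (A B : Interval w) → Covers x (just A) → Covers x (just B) →
    ¬ just A ≈ᴾ just B → lo A ≢ lo B
  covers⇒lo≢ A B cov-A cov-B A≉B loA≡loB with ≤-total (hi A) (hi B)
  ... | inj₁ hiA≤hiB = covers⇒⋢ (just A) (just B) cov-A cov-B A≉B
    (bounds⇒⊑ {A} {B} (≤-reflexive (sym loA≡loB)) hiA≤hiB)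
  ... | inj₂ hiB≤hiA = covers⇒⋢ (just B) (just A) cov-B cov-A (≉-sym {just A} {just B} A≉B)
    (bounds⇒⊑ {B} {A} (≤-reflexive loA≡loB) hiB≤hiA)

  lo-between⇒lower⊑ : (A B C : Interval w) → lo A < lo B → lo B < lo C → ¬ just B ⊑ just A →
    ∀ z → z ⊑ just A → z ⊑ just C → z ⊑ just B
  lo-between⇒lower⊑ A B C loA<loB loB<loC B⋢A z z⊑A z⊑C v v∈z =
    ≤-trans (<⇒≤ loB<loC) (proj₁ (z⊑C v v∈z)) , ≤-trans (proj₂ (z⊑A v v∈z)) hiA≤hiB
    where
    hiA≤hiB : hi A ≤ hi B
    hiA≤hiB with ≤-total (hi A) (hi B)
    ... | inj₁ hiA≤hiB = hiA≤hiB
    ... | inj₂ hiB≤hiA = ⊥-elim (B⋢A (bounds⇒⊑ {B} {A} (<⇒≤ loA<loB) hiB≤hiA))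

  covers-between⇒¬distributive : ∀ {x} (A B C : Interval w) →
    Covers x (just A) → Covers x (just B) → Covers x (just C) →
    ¬ just A ≈ᴾ just B → ¬ just B ≈ᴾ just C → Between (lo A) (lo B) (lo C) → ¬ IsDistributive w
  covers-between⇒¬distributive A B C cov-A cov-B cov-C A≉B B≉C between distributive =
    distributive⇒covers-meet⋢ distributive (just A) (just B) (just C) cov-A cov-B cov-C A≉B B≉C
      (lower⊑B between)
    where
    lower⊑B : Between (lo A) (lo B) (lo C) → ∀ z → z ⊑ just A → z ⊑ just C → z ⊑ just B
    lower⊑B (inj₁ (loA<loB , loB<loC)) =
      lo-between⇒lower⊑ A B C loA<loB loB<loC
        (covers⇒⋢ (just B) (just A) cov-B cov-A (≉-sym {just A} {just B} A≉B))
    lower⊑B (inj₂ (loC<loB , loB<loA)) z z⊑A z⊑C =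
      lo-between⇒lower⊑ C B A loC<loB loB<loA (covers⇒⋢ (just B) (just C) cov-B cov-C B≉C) z z⊑C z⊑A

proposition3p10 : (n : ℕ) (w : Permutation′ n) →
    (∃ λ (x : PBar w) → CoversAtLeast3 x) → ¬ IsDistributive w
proposition3p10 n w (x , nothing , b , _ , cov-a , cov-b , _ , a≉b , _) _ =
  covers⇒⋢ nothing b cov-a cov-b a≉b (λ _ ())
proposition3p10 n w (x , a@(just _) , nothing , _ , cov-a , cov-b , _ , a≉b , _) _ =
  covers⇒⋢ nothing a cov-b cov-a (≉-sym {p = a} a≉b) (λ _ ())
proposition3p10 n w (x , a@(just _) , just _ , nothing , cov-a , _ , cov-c , _ , a≉c , _) _ =
  covers⇒⋢ nothing a cov-c cov-a (≉-sym {p = a} a≉c) (λ _ ())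
proposition3p10 n w (x , just A , just B , just C , cov-A , cov-B , cov-C , A≉B , A≉C , B≉C)
  with some-between (covers⇒lo≢ A B cov-A cov-B A≉B) (covers⇒lo≢ A C cov-A cov-C A≉C)
                    (covers⇒lo≢ B C cov-B cov-C B≉C)
... | inj₁ B-between =
  covers-between⇒¬distributive A B C cov-A cov-B cov-C A≉B B≉C B-between
... | inj₂ (inj₁ A-between) =
  covers-between⇒¬distributive B A C cov-B cov-A cov-C (≉-sym {p = just A} {just B} A≉B) A≉C A-between
... | inj₂ (inj₂ C-between) =
  covers-between⇒¬distributive A C B cov-A cov-C cov-B A≉C (≉-sym {p = just B} {just C} B≉C) C-between
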